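{- Let $G$ be a graph with $V(G)=\{1,\ldots,n\}$, let $w:E(G)\to\mathbb{Z}_{\ge 0}$, $\gamma:E(G)\to\mathrm{GF}(2)^t$, $\alpha\in\mathrm{GF}(2)^t$, and let $c$ be a positive integer. If $\tilde x\in\{1,\ldots,c|V(G)|\}^{E(G)}$ is chosen randomly with uniform probability, then $\operatorname{mindeg}_z(p_\alpha(\tilde x,z))=\operatorname{mindeg}_z(p_\alpha(x,z))$ with probability at least $1-\frac{1}{2c}$.
   Context: Let $x=(x_e: e\in E(G))$ and $z$ be algebraically independent commuting indeterminates. For a perfect matching $M$ of $G$, let $x^M=\prod_{e\in M}x_e$, $w(M)=\sum_{e\in M}w(e)$, $\gamma(M)=\sum_{e\in M}\gamma(e)$. Two edges $e=u_1u_2$, $f=v_1v_2$ with $u_1\le u_2$, $v_1\le v_2$ cross if $u_1<v_1<u_2<v_2$ or $v_1<u_1<v_2<u_2$; the sign $\sigma_M$ of $M$ is $(-1)^k$ where $k$ is the number of crossing pairs of edges in $M$. For $\beta\in\mathrm{GF}(2)^t$ define $p_\beta(x,z)=\sum_M \sigma_M x^M z^{w(M)}\in\mathbb{Z}[x,z]$, the sum over all perfect matchings $M$ of $G$ with $\gamma(M)=\beta$ (these are the coefficients of $y^\beta$ in the Pfaffian of the Tutte matrix of $G$ with $x_e$ replaced by $x_e y^{\gamma(e)}z^{w(e)}$, computed modulo $y_i^2-1$). For a polynomial $p(x,z)$, $\operatorname{mindeg}_z(p)$ is the minimum exponent of $z$ over the terms of $p$, and $\infty$ if $p=0$. $p_\alpha(\tilde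 x,z)$ denotes the evaluation at $x=\tilde x$. -}

module Defs where

open import Data.Nat as ℕ using (ℕ; zero; suc; _+_; _*_; _≡ᵇ_; _<ᵇ_)
open import Data.Bool using (Bool; true; false; _∧_; _∨_; if_then_else_; _xor_)
open import Data.Fin as Fin using (Fin; toℕ)
open import Data.Vec as Vec using (Vec; []; _∷_; lookup; replicate; zipWith)
open import Data.List as List using (List; []; _∷_; allFin; foldr; filter; length)
open import Data.Integer as ℤ using (ℤ; +_; 0ℤ; 1ℤ; -1ℤ)
open import Data.Product using (Σ; ∃; ∃-syntax; _×_; _,_)
open import Data.Maybe using (Maybe; just; nothing)
open import Data.Empty using (⊥)
open import Relation.Nullary using (¬_)
open import Relation.Binary.PropositionalEquality using (_≡_; _≢_)

-- A (simple, loopless) graph on vertex set {1,…,n}, encoded as Fin n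
-- (vertex i ↔ toℕ i + 1, order preserved), with m edges indexed by Fin m.
record Graph (n m : ℕ) : Set where
  field
    src tgt  : Fin m → Fin n
    src<tgt  : ∀ e → src e Fin.< tgt e
    simple   : ∀ e f → src e ≡ src f → tgt e ≡ tgt f → e ≡ f

EdgeSet : ℕ → Set
EdgeSet m = Vec Bool m

allSubsets : (m : ℕ) → List (EdgeSet m)
allSubsets zero    = [] ∷ []
allSubsets (suc m) =
  List.map (false ∷_) (allSubsets m) List.++ List.map (true ∷_) (allSubsets m)

sumℤ : List ℤ → ℤ
sumℤ = foldr ℤ._+_ 0ℤ

prodℤ : List ℤ → ℤ
prodℤ = foldr ℤ._*_ 1ℤ

sumℕ : List ℕ → ℕ
sumℕ = foldr _+_ 0

_=ꟳ_ : ∀ {n} → Fin n → Fin n → Bool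
i =ꟳ j = toℕ i ≡ᵇ toℕ j

_<ꟳ_ : ∀ {n} → Fin n → Fin n → Bool
i <ꟳ j = toℕ i <ᵇ toℕ j

eqVecBool : ∀ {t} → Vec Bool t → Vec Bool t → Bool
eqVecBool []       []       = true
eqVecBool (a ∷ as) (b ∷ bs) = (if a then b else (if b then false else true)) ∧ eqVecBool as bs

eqVecℕ : ∀ {t} → Vec ℕ t → Vec ℕ t → Bool
eqVecℕ []       []       = true
eqVecℕ (a ∷ as) (b ∷ bs) = (a ≡ᵇ b) ∧ eqVecℕ as bs

countB : ∀ {A : Set} → (A → Bool) → List A → ℕ
countB p []       = 0
countB p (x ∷ xs) = (if p x then 1 else 0) + countB p xs

allB : ∀ {A : Set} → (A → Bool) → List A → Bool
allB p []       = true
allB p (x ∷ xs) = p x ∧ allB p xs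

-- mindeg_z of a polynomial given by "coefficient of z^k is nonzero" (NZ k):
-- IsMinDeg NZ d holds iff mindeg_z = d, where nothing stands for ∞.
IsMinDeg : (ℕ → Set) → Maybe ℕ → Set
IsMinDeg NZ (just k) = NZ k × (∀ j → j ℕ.< k → ¬ NZ j)
IsMinDeg NZ nothing  = ∀ k → ¬ NZ k

InRange : ∀ {m} → ℕ → Vec ℕ m → Set
InRange N x̃ = ∀ e → 1 ℕ.≤ lookup x̃ e × lookup x̃ e ℕ.≤ N

-- GF(2)^t represented as Vec Bool t, addition = pointwise xor.
module Setup {n m t : ℕ} (G : Graph n m) (w : Fin m → ℕ)
             (γ : Fin m → Vec Bool t) (α : Vec Bool t) where
  open Graph G

  edges : List (Fin m)
  edges = allFin m

  deg : EdgeSet m → Fin n → ℕ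
  deg M v = countB (λ e → lookup M e ∧ ((src e =ꟳ v) ∨ (tgt e =ꟳ v))) edges

  isPerfectMatching : EdgeSet m → Bool
  isPerfectMatching M = allB (λ v → deg M v ≡ᵇ 1) (allFin n)

  cross : Fin m → Fin m → Bool
  cross e f = ((src e <ꟳ src f) ∧ (src f <ꟳ tgt e) ∧ (tgt e <ꟳ tgt f))
            ∨ ((src f <ꟳ src e) ∧ (src e <ꟳ tgt f) ∧ (tgt f <ꟳ tgt e))

  crossings : EdgeSet m → ℕ
  crossings M = sumℕ (List.map (λ e →
      countB (λ f → (e <ꟳ f) ∧ lookup M e ∧ lookup M f ∧ cross e f) edges) edges)

  sign : EdgeSet m → ℤ
  sign M = -1ℤ ℤ.^ crossings M

  weight : EdgeSet m → ℕ
  weight M = sumℕ (List.map (λ e → if lookup M e then w e else 0) edges)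

  gammaOf : EdgeSet m → Vec Bool t
  gammaOf M = foldr (λ e acc → if lookup M e then zipWith _xor_ (γ e) acc else acc)
                    (replicate t false) edges

  selected : ℕ → EdgeSet m → Bool
  selected k M = isPerfectMatching M ∧ eqVecBool (gammaOf M) α ∧ (weight M ≡ᵇ k)

  expVec : EdgeSet m → Vec ℕ m
  expVec M = Vec.map (λ b → if b then 1 else 0) M

  -- p_α(x,z) = Σ_{M perfect matching, γ(M)=α} σ_M x^M z^{w(M)}, given by its
  -- coefficient function: coefficient of x^v z^k (v ∈ ℕ^E an exponent vector).
  coeffSym : Vec ℕ m → ℕ → ℤ
  coeffSym v k = sumℤ (List.map (λ M →
      if selected k M ∧ eqVecℕ (expVec M) v then sign M else 0ℤ) (allSubsets m))

  -- p_α(x̃,z) ∈ ℤ[z] given by its coefficient function: coefficient of z^k.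
  coeffEval : Vec ℕ m → ℕ → ℤ
  coeffEval x̃ k = sumℤ (List.map (λ M →
      if selected k M
      then sign M ℤ.* prodℤ (List.map (λ e → if lookup M e then + lookup x̃ e else 1ℤ) edges)
      else 0ℤ) (allSubsets m))

  symNZ : ℕ → Set
  symNZ k = ∃[ v ] coeffSym v k ≢ 0ℤ

  evalNZ : Vec ℕ m → ℕ → Set
  evalNZ x̃ k = coeffEval x̃ k ≢ 0ℤ

  SameMinDeg : Vec ℕ m → Set
  SameMinDeg x̃ = ∃[ d ] (IsMinDeg symNZ d × IsMinDeg (evalNZ x̃) d)

-- The lowest coefficient of p_α in z is the coefficient of z^d, where d is the least weight of a
-- perfect matching M with γ(M) = α. As a polynomial in x it is multilinear, nonzero (the monomial
-- x^M of such an M occurs exactly once, with coefficient ±1) and homogeneous of degree n/2, since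
-- every perfect matching has n/2 edges. All lower coefficients vanish identically, so the minimum
-- degree survives the evaluation at x̃ unless x̃ is a zero of that coefficient, and by the
-- Schwartz–Zippel lemma a multilinear polynomial of degree D vanishes at no more than D·S^(m-1) of
-- the S^m points of {1,…,S}^m. With S = c·n and D = n/2 this is a fraction 1/(2c).
module Submission where

open import Defs
open import Data.Nat as ℕ using (ℕ; zero; suc; _+_; _*_; _∸_; _^_; _≤_; _<_; z≤n; s≤s; _≡ᵇ_)
import Data.Nat.Properties as ℕₚ
open import Data.Nat.Tactic.RingSolver using (solve-∀)
open import Data.Bool using (Bool; true; false; T; _∧_; _∨_; if_then_else_)
open import Data.Fin as Fin using (Fin)
open import Data.Vec as Vec using (Vec; []; _∷_; lookup)
open import Data.Vec.Properties using (∷-injective)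
open import Data.List as List
  using (List; []; _∷_; _++_; length; allFin; filter; applyUpTo; cartesianProductWith)
open import Data.List.Properties
  using (map-tabulate; map-cong; map-++; map-∘; length-++; length-map; length-tabulate;
         length-applyUpTo; length-filter; filter-++; filter-none; filter-reject)
open import Data.List.Membership.Propositional using (_∈_)
open import Data.List.Membership.Propositional.Properties
  using (∈-++⁺ˡ; ∈-++⁺ʳ; ∈-map⁺; ∈-cartesianProductWith⁻; ∈-applyUpTo⁻)
open import Data.List.Relation.Unary.All as All using (All; []; _∷_)
open import Data.List.Relation.Unary.All.Properties using (¬All⇒Any¬; all-filter)
  renaming (filter⁺ to All-filter⁺)
open import Data.List.Relation.Unary.Any as Any using (here)
open import Data.List.Relation.Unary.AllPairs using ([]; _∷_)
open import Data.List.Relation.Unary.Unique.Propositional using (Unique)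
open import Data.List.Relation.Unary.Unique.Propositional.Properties
  using (cartesianProductWith⁺; applyUpTo⁺₁) renaming (filter⁺ to Unique-filter⁺)
open import Data.Integer as ℤ using (ℤ; 0ℤ; 1ℤ; -1ℤ)
import Data.Integer.Properties as ℤₚ
open import Algebra.Bundles using (AbelianGroup)
open import Algebra.Properties.CommutativeSemigroup ℤₚ.*-commutativeSemigroup using (x∙yz≈y∙xz)
open import Algebra.Properties.Group (AbelianGroup.group ℤₚ.+-0-abelianGroup) using (∙-cancelˡ)
open import Data.Product using (∃-syntax; _×_; _,_)
open import Data.Maybe using (just; nothing)
open import Data.Sum using (_⊎_; inj₁; inj₂)
open import Function using (_∘_; flip; id)
open import Relation.Nullary using (¬_; yes; no; ¬?; contradiction)
open import Relation.Unary using (Decidable)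
open import Relation.Binary.PropositionalEquality

≡ᵇ-true⇒≡ : ∀ {a b} → (a ≡ᵇ b) ≡ true → a ≡ b
≡ᵇ-true⇒≡ {a} {b} eq = ℕₚ.≡ᵇ⇒≡ a b (subst T (sym eq) _)

if-∧ : ∀ {A : Set} a b (x y : A) → (if a ∧ b then x else y) ≡ (if b then (if a then x else y) else y)
if-∧ true  b     x y = refl
if-∧ false true  x y = refl
if-∧ false false x y = refl

indicator : Bool → ℕ
indicator b = if b then 1 else 0

module _ {A : Set} where

  countB≡sumℕ : ∀ (p : A → Bool) xs → countB p xs ≡ sumℕ (List.map (indicator ∘ p) xs)
  countB≡sumℕ p []       = refl
  countB≡sumℕ p (x ∷ xs) = cong (indicator (p x) +_) (countB≡sumℕ p xs)

  sumℕ-map-cong : ∀ {f g : A → ℕ} → (∀ x → f x ≡ g x) → ∀ xs →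
                  sumℕ (List.map f xs) ≡ sumℕ (List.map g xs)
  sumℕ-map-cong f≗g xs = cong sumℕ (map-cong f≗g xs)

  sumℕ-map-zero : ∀ xs → sumℕ (List.map (λ (_ : A) → 0) xs) ≡ 0
  sumℕ-map-zero []       = refl
  sumℕ-map-zero (x ∷ xs) = sumℕ-map-zero xs

  sumℕ-map-+ : ∀ (f g : A → ℕ) xs →
               sumℕ (List.map (λ x → f x + g x) xs) ≡ sumℕ (List.map f xs) + sumℕ (List.map g xs)
  sumℕ-map-+ f g []       = refl
  sumℕ-map-+ f g (x ∷ xs) = trans (cong (f x + g x +_) (sumℕ-map-+ f g xs))
                                  (interchange (f x) (g x) _ _)
    where
    interchange : ∀ a b c d → a + b + (c + d) ≡ a + c + (b + d)
    interchange = solve-∀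

  sumℕ-map-*ˡ : ∀ k (f : A → ℕ) xs → sumℕ (List.map (λ x → k * f x) xs) ≡ k * sumℕ (List.map f xs)
  sumℕ-map-*ˡ k f []       = sym (ℕₚ.*-zeroʳ k)
  sumℕ-map-*ˡ k f (x ∷ xs) =
    trans (cong (k * f x +_) (sumℕ-map-*ˡ k f xs)) (sym (ℕₚ.*-distribˡ-+ k (f x) _))

  sumℕ-map-≡length : ∀ (f : A → ℕ) xs → allB (λ x → f x ≡ᵇ 1) xs ≡ true →
                     sumℕ (List.map f xs) ≡ length xs
  sumℕ-map-≡length f []       _ = refl
  sumℕ-map-≡length f (x ∷ xs) h with f x ≡ᵇ 1 in fx≡1
  ... | true = cong₂ _+_ (≡ᵇ-true⇒≡ fx≡1) (sumℕ-map-≡length f xs h)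

sumℕ-map-swap : ∀ {A B : Set} (f : A → B → ℕ) xs ys →
  sumℕ (List.map (λ x → sumℕ (List.map (f x) ys)) xs) ≡
  sumℕ (List.map (λ y → sumℕ (List.map (λ x → f x y) xs)) ys)
sumℕ-map-swap f []       ys = sym (sumℕ-map-zero ys)
sumℕ-map-swap f (x ∷ xs) ys =
  trans (cong (sumℕ (List.map (f x) ys) +_) (sumℕ-map-swap f xs ys))
        (sym (sumℕ-map-+ (f x) (λ y → sumℕ (List.map (λ x → f x y) xs)) ys))

sumℤ-++ : ∀ xs ys → sumℤ (xs ++ ys) ≡ sumℤ xs ℤ.+ sumℤ ys
sumℤ-++ []       ys = sym (ℤₚ.+-identityˡ _)
sumℤ-++ (x ∷ xs) ys = trans (cong (λ s → x ℤ.+ s) (sumℤ-++ xs ys)) (sym (ℤₚ.+-assoc x _ _))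

module _ {A : Set} where

  sumℤ-map-cong : ∀ {f g : A → ℤ} → (∀ x → f x ≡ g x) → ∀ xs →
                  sumℤ (List.map f xs) ≡ sumℤ (List.map g xs)
  sumℤ-map-cong f≗g xs = cong sumℤ (map-cong f≗g xs)

  sumℤ-map-zero : ∀ {f : A → ℤ} → (∀ x → f x ≡ 0ℤ) → ∀ xs → sumℤ (List.map f xs) ≡ 0ℤ
  sumℤ-map-zero f≡0 []       = refl
  sumℤ-map-zero f≡0 (x ∷ xs) = cong₂ ℤ._+_ (f≡0 x) (sumℤ-map-zero f≡0 xs)

  sumℤ-map-*ˡ : ∀ a (f : A → ℤ) xs →
                sumℤ (List.map (λ x → a ℤ.* f x) xs) ≡ a ℤ.* sumℤ (List.map f xs)
  sumℤ-map-*ˡ a f []       = sym (ℤₚ.*-zeroʳ a)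
  sumℤ-map-*ˡ a f (x ∷ xs) =
    trans (cong (λ s → a ℤ.* f x ℤ.+ s) (sumℤ-map-*ˡ a f xs)) (sym (ℤₚ.*-distribˡ-+ a (f x) _))

map-allFin-suc : ∀ {A : Set} {m} (f : Fin (suc m) → A) →
                 List.map f (allFin (suc m)) ≡ f Fin.zero ∷ List.map (f ∘ Fin.suc) (allFin m)
map-allFin-suc f =
  trans (map-tabulate id f) (cong (f Fin.zero ∷_) (sym (map-tabulate id (f ∘ Fin.suc))))

sumℕ-indicator-=ꟳ : ∀ {k} (a : Fin k) → sumℕ (List.map (λ v → indicator (a =ꟳ v)) (allFin k)) ≡ 1
sumℕ-indicator-=ꟳ {suc k} Fin.zero    =
  trans (cong sumℕ (map-allFin-suc {m = k} (λ v → indicator (Fin.zero =ꟳ v))))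
        (cong suc (sumℕ-map-zero (allFin k)))
sumℕ-indicator-=ꟳ {suc k} (Fin.suc a) =
  trans (cong sumℕ (map-allFin-suc {m = k} (λ v → indicator (Fin.suc a =ꟳ v)))) (sumℕ-indicator-=ꟳ a)

module _ {A : Set} {P : A → Set} (P? : Decidable P) where

  length-filter-map : ∀ {B : Set} (g : B → A) xs →
                      length (filter P? (List.map g xs)) ≡ length (filter (P? ∘ g) xs)
  length-filter-map g []       = refl
  length-filter-map g (x ∷ xs) with P? (g x)
  ... | yes _ = cong suc (length-filter-map g xs)
  ... | no  _ = length-filter-map g xs

  length-filter-cartesianProductWith : ∀ {B C : Set} (f : B → C → A) xs ys →
    length (filter P? (cartesianProductWith f xs ys)) ≡
    sumℕ (List.map (λ x → length (filter (P? ∘ f x) ys)) xs)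
  length-filter-cartesianProductWith f []       ys = refl
  length-filter-cartesianProductWith f (x ∷ xs) ys = begin
    length (filter P? (List.map (f x) ys ++ cartesianProductWith f xs ys))
      ≡⟨ cong length (filter-++ P? (List.map (f x) ys) _) ⟩
    length (filter P? (List.map (f x) ys) ++ filter P? (cartesianProductWith f xs ys))
      ≡⟨ length-++ (filter P? (List.map (f x) ys)) ⟩
    length (filter P? (List.map (f x) ys)) + length (filter P? (cartesianProductWith f xs ys))
      ≡⟨ cong₂ _+_ (length-filter-map (f x) ys) (length-filter-cartesianProductWith f xs ys) ⟩
    length (filter (P? ∘ f x) ys) + sumℕ (List.map (λ x → length (filter (P? ∘ f x) ys)) xs) ∎
    where open ≡-Reasoning

  length-filter-≤1 : ∀ {xs} → Unique xs → (∀ {a b} → P a → P b → a ≡ b) →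
                     length (filter P? xs) ≤ 1
  length-filter-≤1 {[]}     _                P-unique = z≤n
  length-filter-≤1 {x ∷ xs} (x∉xs ∷ xs-uniq) P-unique with P? x
  ... | no  _  = length-filter-≤1 xs-uniq P-unique
  ... | yes px = s≤s (ℕₚ.≤-reflexive (cong length
                   (filter-none P? (All.map (λ x≢y py → x≢y (P-unique px py)) x∉xs))))

  length-filter-+-¬? : ∀ xs → length (filter (¬? ∘ P?) xs) + length (filter P? xs) ≡ length xs
  length-filter-+-¬? []       = refl
  length-filter-+-¬? (x ∷ xs) with P? x
  ... | yes _ = trans (ℕₚ.+-suc _ _) (cong suc (length-filter-+-¬? xs))
  ... | no  _ = cong suc (length-filter-+-¬? xs)

  sumℕ-≤-filter : ∀ {S K} (h : A → ℕ) → (∀ x → h x ≤ S) → (∀ x → ¬ P x → h x ≤ K) → ∀ xs →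
                  sumℕ (List.map h xs) ≤ S * length (filter P? xs) + K * length xs
  sumℕ-≤-filter h h≤S _ [] = z≤n
  sumℕ-≤-filter {S} {K} h h≤S h≤K (x ∷ xs) with P? x
  ... | yes _ = ℕₚ.≤-trans (ℕₚ.+-mono-≤ (h≤S x) (sumℕ-≤-filter h h≤S h≤K xs))
                  (ℕₚ.≤-trans (ℕₚ.m≤m+n _ K) (ℕₚ.≤-reflexive (regroup S _ K _)))
    where
    regroup : ∀ S f K l → S + (S * f + K * l) + K ≡ S * suc f + K * suc l
    regroup = solve-∀
  ... | no ¬px = ℕₚ.≤-trans (ℕₚ.+-mono-≤ (h≤K x ¬px) (sumℕ-≤-filter h h≤S h≤K xs))
                   (ℕₚ.≤-reflexive (regroup S _ K _))
    where
    regroup : ∀ S f K l → K + (S * f + K * l) ≡ S * f + K * suc l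
    regroup = solve-∀

  length-filter-¬?-fraction : ∀ k xs → k * length (filter P? xs) ≤ length xs →
                              (k ∸ 1) * length xs ≤ k * length (filter (¬? ∘ P?) xs)
  length-filter-¬?-fraction k xs bound = begin
    (k ∸ 1) * N         ≡⟨ trans (ℕₚ.*-distribʳ-∸ N k 1) (cong (k * N ∸_) (ℕₚ.+-identityʳ N)) ⟩
    k * N ∸ N           ≤⟨ ℕₚ.m≤n+o⇒m∸n≤o (k * N) N (begin
      k * N             ≡⟨ cong (k *_) (sym (length-filter-+-¬? xs)) ⟩
      k * (ℓ + z)       ≡⟨ ℕₚ.*-distribˡ-+ k ℓ z ⟩
      k * ℓ + k * z     ≤⟨ ℕₚ.+-monoʳ-≤ (k * ℓ) bound ⟩
      k * ℓ + N         ≡⟨ ℕₚ.+-comm (k * ℓ) N ⟩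
      N + k * ℓ         ∎) ⟩
    k * ℓ               ∎
    where
    open ℕₚ.≤-Reasoning
    N = length xs
    ℓ = length (filter (¬? ∘ P?) xs)
    z = length (filter P? xs)

minimal-by : ∀ {A : Set} (P : A → Bool) (f : A → ℕ) xs →
  All (λ x → P x ≡ false) xs ⊎ ∃[ x ] (P x ≡ true × All (λ y → P y ≡ true → f x ≤ f y) xs)
minimal-by P f [] = inj₁ []
minimal-by P f (x ∷ xs) with P x in Px | minimal-by P f xs
... | false | inj₁ none = inj₁ (Px ∷ none)
... | false | inj₂ (y , Py , y-min) =
  inj₂ (y , Py , (λ Px≡true → contradiction (trans (sym Px) Px≡true) λ ()) ∷ y-min)
... | true  | inj₁ none = inj₂ (x , Px , (λ _ → ℕₚ.≤-refl) ∷
  All.map (λ Py≡false Py≡true → contradiction (trans (sym Py≡false) Py≡true) λ ()) none)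
... | true  | inj₂ (y , Py , y-min) with f x ℕₚ.≤? f y
...   | yes fx≤fy = inj₂ (x , Px , (λ _ → ℕₚ.≤-refl) ∷ All.map (ℕₚ.≤-trans fx≤fy ∘_) y-min)
...   | no  fx≰fy = inj₂ (y , Py , (λ _ → ℕₚ.≰⇒≥ fx≰fy) ∷ y-min)

∈-allSubsets : ∀ {m} (M : Vec Bool m) → M ∈ allSubsets m
∈-allSubsets []          = here refl
∈-allSubsets (false ∷ M) = ∈-++⁺ˡ (∈-map⁺ (false ∷_) (∈-allSubsets M))
∈-allSubsets (true ∷ M)  = ∈-++⁺ʳ _ (∈-map⁺ (true ∷_) (∈-allSubsets M))

sumℤ-allSubsets-suc : ∀ {m} (F : Vec Bool (suc m) → ℤ) →
  sumℤ (List.map F (allSubsets (suc m))) ≡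
  sumℤ (List.map (F ∘ (false ∷_)) (allSubsets m)) ℤ.+ sumℤ (List.map (F ∘ (true ∷_)) (allSubsets m))
sumℤ-allSubsets-suc {m} F =
  trans (cong sumℤ (map-++ F (List.map (false ∷_) subsets) _))
        (trans (sumℤ-++ (List.map F (List.map (false ∷_) subsets)) _)
               (sym (cong₂ (λ u v → sumℤ u ℤ.+ sumℤ v) (map-∘ subsets) (map-∘ subsets))))
  where subsets = allSubsets m

sumℤ-matching-exponents : ∀ {m} (F : Vec Bool m → ℤ) M₀ →
  sumℤ (List.map (λ M → if eqVecℕ (Vec.map indicator M) (Vec.map indicator M₀) then F M else 0ℤ)
                 (allSubsets m)) ≡ F M₀
sumℤ-matching-exponents F [] = ℤₚ.+-identityʳ (F [])
sumℤ-matching-exponents {suc m} F (false ∷ M₀) = trans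
  (sumℤ-allSubsets-suc (λ M → if eqVecℕ (Vec.map indicator M) (0 ∷ Vec.map indicator M₀) then F M else 0ℤ))
  (trans (cong₂ ℤ._+_ (sumℤ-matching-exponents (F ∘ (false ∷_)) M₀) (sumℤ-map-zero (λ _ → refl) (allSubsets m)))
         (ℤₚ.+-identityʳ _))
sumℤ-matching-exponents {suc m} F (true ∷ M₀) = trans
  (sumℤ-allSubsets-suc (λ M → if eqVecℕ (Vec.map indicator M) (1 ∷ Vec.map indicator M₀) then F M else 0ℤ))
  (trans (cong₂ ℤ._+_ (sumℤ-map-zero (λ _ → refl) (allSubsets m)) (sumℤ-matching-exponents (F ∘ (true ∷_)) M₀))
         (ℤₚ.+-identityˡ _))

vanishes-or-nonzero : ∀ {m} (p : Vec Bool m → ℤ) → (∀ M → p M ≡ 0ℤ) ⊎ ∃[ M ] p M ≢ 0ℤ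
vanishes-or-nonzero {m} p with All.all? (λ M → p M ℤ.≟ 0ℤ) (allSubsets m)
... | yes p≡0 = inj₁ (λ M → All.lookup p≡0 (∈-allSubsets M))
... | no  p≢0 = inj₂ (Any.satisfied (¬All⇒Any¬ (λ M → p M ℤ.≟ 0ℤ) _ p≢0))

nonzero-restriction : ∀ {m} (p : Vec Bool (suc m) → ℤ) → (∀ M → p (true ∷ M) ≡ 0ℤ) →
                      ∃[ M ] p M ≢ 0ℤ → ∃[ M ] p (false ∷ M) ≢ 0ℤ
nonzero-restriction p p₁≡0 (false ∷ M , pM≢0) = M , pM≢0
nonzero-restriction p p₁≡0 (true ∷ M , pM≢0)  = contradiction (p₁≡0 M) pM≢0

size : ∀ {m} → Vec Bool m → ℕ
size []      = 0
size (b ∷ M) = indicator b + size M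

countB-lookup : ∀ {m} (M : Vec Bool m) → countB (lookup M) (allFin m) ≡ size M
countB-lookup []          = refl
countB-lookup {suc m} (b ∷ M) = cong (indicator b +_) (begin
  countB (lookup (b ∷ M)) (List.tabulate Fin.suc)
    ≡⟨ cong (countB (lookup (b ∷ M))) (sym (map-tabulate id Fin.suc)) ⟩
  countB (lookup (b ∷ M)) (List.map Fin.suc (allFin m))  ≡⟨ countB-map (allFin m) ⟩
  countB (lookup M) (allFin m)                           ≡⟨ countB-lookup M ⟩
  size M                                                 ∎)
  where
  open ≡-Reasoning
  countB-map : ∀ xs → countB (lookup (b ∷ M)) (List.map Fin.suc xs) ≡ countB (lookup M) xs
  countB-map []       = refl
  countB-map (x ∷ xs) = cong (indicator (lookup M x) +_) (countB-map xs)

-- Multilinear polynomials in m variables, given by their coefficients on subsets of the variables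

monomial : ∀ {m} → Vec Bool m → Vec ℕ m → ℤ
monomial {m} M x = prodℤ (List.map (λ e → if lookup M e then ℤ.+ lookup x e else 1ℤ) (allFin m))

eval : ∀ {m} → (Vec Bool m → ℤ) → Vec ℕ m → ℤ
eval {m} p x = sumℤ (List.map (λ M → p M ℤ.* monomial M x) (allSubsets m))

monomial-∷ : ∀ {m} b (M : Vec Bool m) a x →
             monomial (b ∷ M) (a ∷ x) ≡ (if b then ℤ.+ a else 1ℤ) ℤ.* monomial M x
monomial-∷ b M a x = cong prodℤ (map-allFin-suc (λ e → if lookup (b ∷ M) e then ℤ.+ lookup (a ∷ x) e else 1ℤ))

eval-∷ : ∀ {m} (p : Vec Bool (suc m) → ℤ) a x →
         eval p (a ∷ x) ≡ eval (p ∘ (false ∷_)) x ℤ.+ ℤ.+ a ℤ.* eval (p ∘ (true ∷_)) x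
eval-∷ {m} p a x = trans (sumℤ-allSubsets-suc (λ M → p M ℤ.* monomial M (a ∷ x))) (cong₂ ℤ._+_
  (sumℤ-map-cong (λ M → cong (p (false ∷ M) ℤ.*_)
                   (trans (monomial-∷ false M a x) (ℤₚ.*-identityˡ _))) subsets)
  (trans (sumℤ-map-cong (λ M → trans (cong (p (true ∷ M) ℤ.*_) (monomial-∷ true M a x))
                                     (x∙yz≈y∙xz (p (true ∷ M)) (ℤ.+ a) _)) subsets)
         (sumℤ-map-*ˡ (ℤ.+ a) _ subsets)))
  where subsets = allSubsets m

eval-vanishing : ∀ {m} (p : Vec Bool m → ℤ) → (∀ M → p M ≡ 0ℤ) → ∀ x → eval p x ≡ 0ℤ
eval-vanishing {m} p p≡0 x =
  sumℤ-map-zero (λ M → trans (cong (ℤ._* monomial M x) (p≡0 M)) (ℤₚ.*-zeroˡ (monomial M x))) (allSubsets m)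

eval-∷-x₀-free : ∀ {m} (p : Vec Bool (suc m) → ℤ) → (∀ M → p (true ∷ M) ≡ 0ℤ) →
                 ∀ a x → eval p (a ∷ x) ≡ eval (p ∘ (false ∷_)) x
eval-∷-x₀-free p p₁≡0 a x = begin
  eval p (a ∷ x)                            ≡⟨ eval-∷ p a x ⟩
  p₀ ℤ.+ ℤ.+ a ℤ.* eval (p ∘ (true ∷_)) x   ≡⟨ cong (λ u → p₀ ℤ.+ ℤ.+ a ℤ.* u) (eval-vanishing _ p₁≡0 x) ⟩
  p₀ ℤ.+ ℤ.+ a ℤ.* 0ℤ                       ≡⟨ cong (λ u → p₀ ℤ.+ u) (ℤₚ.*-zeroʳ (ℤ.+ a)) ⟩
  p₀ ℤ.+ 0ℤ                                 ≡⟨ ℤₚ.+-identityʳ p₀ ⟩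
  p₀                                        ∎
  where
  open ≡-Reasoning
  p₀ = eval (p ∘ (false ∷_)) x

eval-nullary : (p : Vec Bool 0 → ℤ) → eval p [] ≡ p []
eval-nullary p = trans (ℤₚ.+-identityʳ _) (ℤₚ.*-identityʳ _)

affine-root-unique : ∀ s t {a b} → t ≢ 0ℤ →
                     s ℤ.+ ℤ.+ a ℤ.* t ≡ 0ℤ → s ℤ.+ ℤ.+ b ℤ.* t ≡ 0ℤ → a ≡ b
affine-root-unique s t t≢0 a-root b-root = ℤₚ.+-injective
  (ℤₚ.*-cancelʳ-≡ _ _ t (∙-cancelˡ s _ _ (trans a-root (sym b-root))))
  where instance _ = ℤ.≢-nonZero t≢0

grid : List ℕ → (m : ℕ) → List (Vec ℕ m)
grid T zero    = [] ∷ []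
grid T (suc m) = cartesianProductWith (flip _∷_) (grid T m) T

length-cartesianProductWith : ∀ {A B C : Set} (f : A → B → C) xs ys →
  length (cartesianProductWith f xs ys) ≡ length xs * length ys
length-cartesianProductWith f []       ys = refl
length-cartesianProductWith f (x ∷ xs) ys = trans (length-++ (List.map (f x) ys))
  (cong₂ _+_ (length-map (f x) ys) (length-cartesianProductWith f xs ys))

length-grid : ∀ T m → length (grid T m) ≡ length T ^ m
length-grid T zero    = refl
length-grid T (suc m) = trans (length-cartesianProductWith (flip _∷_) (grid T m) T)
  (trans (ℕₚ.*-comm (length (grid T m)) _) (cong (length T *_) (length-grid T m)))

grid-unique : ∀ {T} → Unique T → ∀ m → Unique (grid T m)
grid-unique T-uniq zero    = [] ∷ []
grid-unique T-uniq (suc m) = cartesianProductWith⁺ (flip _∷_) swap-injective (grid-unique T-uniq m) T-uniq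
  where
  swap-injective : ∀ {x y : Vec ℕ m} {a b} → a ∷ x ≡ b ∷ y → x ≡ y × a ≡ b
  swap-injective eq = let (a≡b , x≡y) = ∷-injective eq in x≡y , a≡b

grid-All : ∀ {P : ℕ → Set} {T} → All P T → ∀ m → All (λ x → ∀ e → P (lookup x e)) (grid T m)
grid-All all-T zero    = (λ ()) ∷ []
grid-All {P} {T} all-T (suc m) = All.tabulate λ v∈ →
  let (x , a , x∈ , a∈ , v≡) = ∈-cartesianProductWith⁻ (flip _∷_) (grid T m) T v∈ in
  subst (λ v → ∀ e → P (lookup v e)) (sym v≡)
    λ { Fin.zero → All.lookup all-T a∈ ; (Fin.suc e) → All.lookup (grid-All all-T m) x∈ e }

zeroCount : ∀ {A : Set} → (A → ℤ) → List A → ℕ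
zeroCount f xs = length (filter (λ x → f x ℤ.≟ 0ℤ) xs)

module SchwartzZippel (T : List ℕ) (T-uniq : Unique T) where

  S : ℕ
  S = length T

  zeros : ∀ {m} → (Vec ℕ m → ℤ) → ℕ
  zeros {m} f = zeroCount f (grid T m)

  zeros-nullary : (p : Vec Bool 0 → ℤ) → p [] ≢ 0ℤ → zeros (eval p) ≡ 0
  zeros-nullary p p≢0 =
    cong length (filter-reject (λ x → eval p x ℤ.≟ 0ℤ) (p≢0 ∘ trans (sym (eval-nullary p))))

  zeros-by-fibres : ∀ {m} (f : Vec ℕ (suc m) → ℤ) (g : Vec ℕ m → ℤ) K →
    (∀ x → g x ≢ 0ℤ → zeroCount (λ a → f (a ∷ x)) T ≤ K) → zeros f ≤ S * zeros g + K * S ^ m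
  zeros-by-fibres {m} f g K fibre≤K = begin
    zeros f
      ≡⟨ length-filter-cartesianProductWith (λ x → f x ℤ.≟ 0ℤ) (flip _∷_) (grid T m) T ⟩
    sumℕ (List.map (λ x → zeroCount (λ a → f (a ∷ x)) T) (grid T m))
      ≤⟨ sumℕ-≤-filter (λ x → g x ℤ.≟ 0ℤ) _ (λ x → length-filter _ T) fibre≤K (grid T m) ⟩
    S * zeros g + K * length (grid T m)
      ≡⟨ cong (λ l → S * zeros g + K * l) (length-grid T m) ⟩
    S * zeros g + K * S ^ m ∎
    where open ℕₚ.≤-Reasoning

  zeros-≤-x₀-free : ∀ {m} (p : Vec Bool (suc m) → ℤ) →
    (∀ M → p (true ∷ M) ≡ 0ℤ) → zeros (eval p) ≤ S * zeros (eval (p ∘ (false ∷_))) + 0 * S ^ m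
  zeros-≤-x₀-free p p₁≡0 = zeros-by-fibres _ _ 0 λ x p₀≢0 →
    ℕₚ.≤-reflexive (cong length (filter-none (λ a → eval p (a ∷ x) ℤ.≟ 0ℤ) {T} (All.tabulate λ {a} _ →
      p₀≢0 ∘ trans (sym (eval-∷-x₀-free p p₁≡0 a x)))))

  zeros-≤-via-x₀-coefficient : ∀ {m} (p : Vec Bool (suc m) → ℤ) →
    zeros (eval p) ≤ S * zeros (eval (p ∘ (true ∷_))) + 1 * S ^ m
  zeros-≤-via-x₀-coefficient p = zeros-by-fibres _ _ 1 λ x p₁≢0 →
    length-filter-≤1 (λ a → eval p (a ∷ x) ℤ.≟ 0ℤ) T-uniq λ {a} {b} a-root b-root →
      affine-root-unique (eval (p ∘ (false ∷_)) x) _ p₁≢0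
        (trans (sym (eval-∷ p a x)) a-root) (trans (sym (eval-∷ p b x)) b-root)

  schwartz-zippel-step : ∀ {z z′ P} K D → z ≤ S * z′ + K * P → z′ * S ≤ D * P → z * S ≤ (K + D) * (S * P)
  schwartz-zippel-step {z} {z′} {P} K D z≤ z′S≤ = begin
    z * S                       ≤⟨ ℕₚ.*-monoˡ-≤ S z≤ ⟩
    (S * z′ + K * P) * S        ≡⟨ regroup₁ S z′ K P ⟩
    S * (z′ * S) + K * (S * P)  ≤⟨ ℕₚ.+-monoˡ-≤ _ (ℕₚ.*-monoʳ-≤ S z′S≤) ⟩
    S * (D * P) + K * (S * P)   ≡⟨ regroup₂ S D K P ⟩
    (K + D) * (S * P)           ∎
    where
    open ℕₚ.≤-Reasoning
    regroup₁ : ∀ S z′ K P → (S * z′ + K * P) * S ≡ S * (z′ * S) + K * (S * P)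
    regroup₁ = solve-∀
    regroup₂ : ∀ S D K P → S * (D * P) + K * (S * P) ≡ (K + D) * (S * P)
    regroup₂ = solve-∀

  schwartz-zippel : ∀ {m} (p : Vec Bool m → ℤ) D → ∃[ M ] p M ≢ 0ℤ →
                    (∀ M → p M ≢ 0ℤ → size M ≤ D) → zeros (eval p) * S ≤ D * S ^ m
  schwartz-zippel {zero} p D ([] , p≢0) _ rewrite zeros-nullary p p≢0 = z≤n
  schwartz-zippel {suc m} p D p≢0 deg≤D with vanishes-or-nonzero (p ∘ (true ∷_))
  ... | inj₁ p₁≡0 = schwartz-zippel-step 0 D (zeros-≤-x₀-free p p₁≡0)
                      (schwartz-zippel (p ∘ (false ∷_)) D (nonzero-restriction p p₁≡0 p≢0)
                        (λ M → deg≤D (false ∷ M)))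
  -- D = 0 cannot occur here: the last argument would prove 1 + size M₁ ≤ 0.
  ... | inj₂ (M₁ , p₁M₁≢0) with D | deg≤D | deg≤D (true ∷ M₁) p₁M₁≢0
  ...   | suc D′ | deg≤1+D′ | _ = schwartz-zippel-step 1 D′ (zeros-≤-via-x₀-coefficient p)
                                   (schwartz-zippel (p ∘ (true ∷_)) D′ (M₁ , p₁M₁≢0)
                                     (λ M p₁M≢0 → ℕ.s≤s⁻¹ (deg≤1+D′ (true ∷ M) p₁M≢0)))

  -- Needed besides schwartz-zippel, which says nothing when S = 0.
  zeros-of-nonzero-constant : ∀ {m} (p : Vec Bool m → ℤ) → ∃[ M ] p M ≢ 0ℤ →
                              (∀ M → p M ≢ 0ℤ → size M ≤ 0) → zeros (eval p) ≡ 0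
  zeros-of-nonzero-constant {zero}  p ([] , p≢0) _ = zeros-nullary p p≢0
  zeros-of-nonzero-constant {suc m} p p≢0 constant = ℕₚ.n≤0⇒n≡0 (begin
    zeros (eval p)                                    ≤⟨ zeros-≤-x₀-free p p₁≡0 ⟩
    S * zeros (eval (p ∘ (false ∷_))) + 0 * S ^ m
      ≡⟨ cong (λ z → S * z + 0) (zeros-of-nonzero-constant (p ∘ (false ∷_))
                                  (nonzero-restriction p p₁≡0 p≢0) (λ M → constant (false ∷ M))) ⟩
    S * 0 + 0                                         ≡⟨ cong (_+ 0) (ℕₚ.*-zeroʳ S) ⟩
    0                                                 ∎)
    where
    open ℕₚ.≤-Reasoning
    p₁≡0 : ∀ M → p (true ∷ M) ≡ 0ℤ
    p₁≡0 M with p (true ∷ M) ℤ.≟ 0ℤ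
    ... | yes p₁M≡0 = p₁M≡0
    ... | no  p₁M≢0 = contradiction (constant (true ∷ M) p₁M≢0) λ ()

fraction-bound : ∀ c {D n z P} → 2 * D ≡ n → z * (c * n) ≤ D * P → (D ≡ 0 → z ≡ 0) → 2 * c * z ≤ P
fraction-bound c {zero} {z = z} refl _ z≡0 rewrite z≡0 refl | ℕₚ.*-zeroʳ (2 * c) = z≤n
fraction-bound c {suc D} {z = z} {P} refl bound _ = ℕₚ.*-cancelˡ-≤ (suc D) (begin
  suc D * (2 * c * z)          ≡⟨ regroup (suc D) c z ⟩
  z * (c * (2 * suc D))        ≤⟨ bound ⟩
  suc D * P                    ∎)
  where
  open ℕₚ.≤-Reasoning
  regroup : ∀ D c z → D * (2 * c * z) ≡ z * (c * (2 * D))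
  regroup = solve-∀

line : ℕ → List ℕ
line N = applyUpTo suc N

line-unique : ∀ N → Unique (line N)
line-unique N = applyUpTo⁺₁ suc N (λ i<j _ → ℕₚ.<⇒≢ i<j ∘ ℕₚ.suc-injective)

line-bounds : ∀ N → All (λ a → 1 ≤ a × a ≤ N) (line N)
line-bounds N = All.tabulate λ a∈ → let (i , i<N , a≡1+i) = ∈-applyUpTo⁻ suc a∈ in
  subst (λ a → 1 ≤ a × a ≤ N) (sym a≡1+i) (s≤s z≤n , i<N)

length-grid-line : ∀ N m → length (grid (line N) m) ≡ N ^ m
length-grid-line N m = trans (length-grid (line N) m) (cong (_^ m) (length-applyUpTo suc N))

DenseSubgrid : ∀ {m} → ℕ → ℕ → (Vec ℕ m → Set) → Set
DenseSubgrid {m} N k Q =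
  ∃[ L ] (Unique L × All (InRange N) L × All Q L × (k ∸ 1) * N ^ m ≤ k * length L)

whole-grid : ∀ {m} N k {Q : Vec ℕ m → Set} → (∀ x → Q x) → DenseSubgrid N k Q
whole-grid {m} N k Q-all =
  grid (line N) m , grid-unique (line-unique N) m , grid-All (line-bounds N) m ,
  All.tabulate (λ {x} _ → Q-all x) ,
  ℕₚ.*-mono-≤ (ℕₚ.m∸n≤m k 1) (ℕₚ.≤-reflexive (sym (length-grid-line N m)))

dense-subgrid : ∀ {m} N k {Q P : Vec ℕ m → Set} (P? : Decidable P) → (∀ x → ¬ P x → Q x) →
                k * length (filter P? (grid (line N) m)) ≤ N ^ m → DenseSubgrid N k Q
dense-subgrid {m} N k P? ¬P⇒Q bound =
  filter (¬? ∘ P?) points ,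
  Unique-filter⁺ (¬? ∘ P?) (grid-unique (line-unique N) m) ,
  All-filter⁺ (¬? ∘ P?) (grid-All (line-bounds N) m) ,
  All.map (λ {x} → ¬P⇒Q x) (all-filter (¬? ∘ P?) points) ,
  subst (λ l → (k ∸ 1) * l ≤ k * length (filter (¬? ∘ P?) points)) (length-grid-line N m)
    (length-filter-¬?-fraction P? k points
      (subst (k * length (filter P? points) ≤_) (sym (length-grid-line N m)) bound))
  where points = grid (line N) m

module MinDegree {n m t : ℕ} (G : Graph n m) (w : Fin m → ℕ) (γ : Fin m → Vec Bool t) (α : Vec Bool t)
  where
  open Setup G w γ α
  open Graph G

  incident : Fin m → Fin n → Bool
  incident e v = (src e =ꟳ v) ∨ (tgt e =ꟳ v)

  indicator-incident : ∀ e v → indicator (incident e v) ≡ indicator (src e =ꟳ v) + indicator (tgt e =ꟳ v)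
  indicator-incident e v with src e =ꟳ v in src≡v | tgt e =ꟳ v in tgt≡v
  ... | true  | true  = contradiction (trans (≡ᵇ-true⇒≡ src≡v) (sym (≡ᵇ-true⇒≡ tgt≡v))) (ℕₚ.<⇒≢ (src<tgt e))
  ... | true  | false = refl
  ... | false | true  = refl
  ... | false | false = refl

  edge-degree : ∀ b e → sumℕ (List.map (λ v → indicator (b ∧ incident e v)) (allFin n)) ≡ 2 * indicator b
  edge-degree false e = sumℕ-map-zero (allFin n)
  edge-degree true  e = trans (sumℕ-map-cong (indicator-incident e) (allFin n))
    (trans (sumℕ-map-+ _ _ (allFin n)) (cong₂ _+_ (sumℕ-indicator-=ꟳ (src e)) (sumℕ-indicator-=ꟳ (tgt e))))

  degree-sum : ∀ M → sumℕ (List.map (deg M) (allFin n)) ≡ 2 * size M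
  degree-sum M = begin
    sumℕ (List.map (deg M) (allFin n))
      ≡⟨ sumℕ-map-cong (λ v → countB≡sumℕ _ edges) (allFin n) ⟩
    sumℕ (List.map (λ v → sumℕ (List.map (λ e → indicator (lookup M e ∧ incident e v)) edges)) (allFin n))
      ≡⟨ sumℕ-map-swap (λ v e → indicator (lookup M e ∧ incident e v)) (allFin n) edges ⟩
    sumℕ (List.map (λ e → sumℕ (List.map (λ v → indicator (lookup M e ∧ incident e v)) (allFin n))) edges)
      ≡⟨ sumℕ-map-cong (λ e → edge-degree (lookup M e) e) edges ⟩
    sumℕ (List.map (λ e → 2 * indicator (lookup M e)) edges)
      ≡⟨ sumℕ-map-*ˡ 2 (indicator ∘ lookup M) edges ⟩
    2 * sumℕ (List.map (indicator ∘ lookup M) edges)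
      ≡⟨ cong (2 *_) (trans (sym (countB≡sumℕ (lookup M) edges)) (countB-lookup M)) ⟩
    2 * size M ∎
    where open ≡-Reasoning

  perfectMatching-size : ∀ M → isPerfectMatching M ≡ true → 2 * size M ≡ n
  perfectMatching-size M pm = trans (sym (degree-sum M))
    (trans (sumℕ-map-≡length (deg M) (allFin n) pm) (length-tabulate id))

  selected⇒perfectMatching : ∀ {k} M → selected k M ≡ true → isPerfectMatching M ≡ true
  selected⇒perfectMatching M sel with isPerfectMatching M
  ... | true = refl

  selected⇒weight : ∀ {k} M → selected k M ≡ true → weight M ≡ k
  selected⇒weight {k} M sel with isPerfectMatching M | eqVecBool (gammaOf M) α | weight M ≡ᵇ k in w≡k
  ... | true | true | true = ≡ᵇ-true⇒≡ w≡k

  selected⇒size : ∀ {k} M → selected k M ≡ true → 2 * size M ≡ n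
  selected⇒size M = perfectMatching-size M ∘ selected⇒perfectMatching M

  -- M is a perfect matching with γ(M) = α; the weight test in selected is then trivial.
  isαMatching : Vec Bool m → Bool
  isαMatching M = selected (weight M) M

  selected⇒isαMatching : ∀ {k} M → selected k M ≡ true → isαMatching M ≡ true
  selected⇒isαMatching M sel = subst (λ k → selected k M ≡ true) (sym (selected⇒weight M sel)) sel

  lightest-matching : (∀ M → isαMatching M ≡ false) ⊎
                      ∃[ M* ] (isαMatching M* ≡ true × ∀ M → isαMatching M ≡ true → weight M* ≤ weight M)
  lightest-matching with minimal-by isαMatching weight (allSubsets m)
  ... | inj₁ none = inj₁ (λ M → All.lookup none (∈-allSubsets M))
  ... | inj₂ (M* , M*-matching , lightest) =
    inj₂ (M* , M*-matching , λ M → All.lookup lightest (∈-allSubsets M))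

  -- The coefficient of z^k in p_α(x, z), as a multilinear polynomial in x.
  coefficient : ℕ → Vec Bool m → ℤ
  coefficient k M = if selected k M then sign M else 0ℤ

  coefficient≢0⇒selected : ∀ {k} M → coefficient k M ≢ 0ℤ → selected k M ≡ true
  coefficient≢0⇒selected {k} M c≢0 with selected k M
  ... | true  = refl
  ... | false = contradiction refl c≢0

  sign≢0 : ∀ M → sign M ≢ 0ℤ
  sign≢0 M sign≡0 with ℤₚ.i^n≡0⇒i≡0 -1ℤ (crossings M) sign≡0
  ... | ()

  coeffEval≡eval : ∀ x k → coeffEval x k ≡ eval (coefficient k) x
  coeffEval≡eval x k = sumℤ-map-cong term (allSubsets m)
    where
    term : ∀ M → (if selected k M then sign M ℤ.* monomial M x else 0ℤ) ≡ coefficient k M ℤ.* monomial M x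
    term M with selected k M
    ... | true  = refl
    ... | false = refl

  coeffSym-expVec : ∀ k M → coeffSym (expVec M) k ≡ coefficient k M
  coeffSym-expVec k M₀ = trans
    (sumℤ-map-cong (λ M → if-∧ (selected k M) (eqVecℕ (expVec M) (expVec M₀)) (sign M) 0ℤ) (allSubsets m))
    (sumℤ-matching-exponents (coefficient k) M₀)

  coeffSym-vanishing : ∀ {k} → (∀ M → selected k M ≡ false) → ∀ v → coeffSym v k ≡ 0ℤ
  coeffSym-vanishing none v = sumℤ-map-zero
    (λ M → cong (λ b → if b ∧ eqVecℕ (expVec M) v then sign M else 0ℤ) (none M)) (allSubsets m)

  coeffEval-vanishing : ∀ {k} → (∀ M → selected k M ≡ false) → ∀ x → coeffEval x k ≡ 0ℤ
  coeffEval-vanishing {k} none x = trans (coeffEval≡eval x k)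
    (eval-vanishing (coefficient k) (λ M → cong (λ b → if b then sign M else 0ℤ) (none M)) x)

  no-matching⇒sameMinDeg : (∀ M → isαMatching M ≡ false) → ∀ x → SameMinDeg x
  no-matching⇒sameMinDeg none x =
    nothing , (λ k (v , c≢0) → c≢0 (coeffSym-vanishing (unselected k) v)) ,
              (λ k c≢0 → c≢0 (coeffEval-vanishing (unselected k) x))
    where
    unselected : ∀ k M → selected k M ≡ false
    unselected k M with selected k M in sel
    ... | false = refl
    ... | true  = contradiction (trans (sym (selected⇒isαMatching M sel)) (none M)) λ ()

  module Lightest (M* : Vec Bool m) (M*-matching : isαMatching M* ≡ true)
                  (lightest : ∀ M → isαMatching M ≡ true → weight M* ≤ weight M) where

    d : ℕ
    d = weight M*

    unselected-below : ∀ {j} → j < d → ∀ M → selected j M ≡ false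
    unselected-below {j} j<d M with selected j M in sel
    ... | false = refl
    ... | true  = contradiction
      (subst (d ≤_) (selected⇒weight M sel) (lightest M (selected⇒isαMatching M sel))) (ℕₚ.<⇒≱ j<d)

    coefficient-M* : coefficient d M* ≢ 0ℤ
    coefficient-M* = subst (λ b → (if b then sign M* else 0ℤ) ≢ 0ℤ) (sym M*-matching) (sign≢0 M*)

    coefficient-size : ∀ M → coefficient d M ≢ 0ℤ → size M ≤ size M*
    coefficient-size M c≢0 = ℕₚ.≤-reflexive (ℕₚ.*-cancelˡ-≡ _ _ 2
      (trans (selected⇒size M (coefficient≢0⇒selected M c≢0)) (sym (selected⇒size M* M*-matching))))

    sameMinDeg : ∀ x → eval (coefficient d) x ≢ 0ℤ → SameMinDeg x
    sameMinDeg x p≢0 =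
      just d ,
      ((expVec M* , coefficient-M* ∘ trans (sym (coeffSym-expVec d M*))) ,
        λ j j<d (v , c≢0) → c≢0 (coeffSym-vanishing (unselected-below j<d) v)) ,
      (p≢0 ∘ trans (sym (coeffEval≡eval x d)) ,
        λ j j<d c≢0 → c≢0 (coeffEval-vanishing (unselected-below j<d) x))

    zeros-fraction : ∀ c → 2 * c * zeroCount (eval (coefficient d)) (grid (line (c * n)) m) ≤ (c * n) ^ m
    zeros-fraction c = fraction-bound c (selected⇒size M* M*-matching) bound no-zeros-if-constant
      where
      open SchwartzZippel (line (c * n)) (line-unique (c * n))
      bound : zeros (eval (coefficient d)) * (c * n) ≤ size M* * (c * n) ^ m
      bound = subst (λ S → zeros (eval (coefficient d)) * S ≤ size M* * S ^ m) (length-applyUpTo suc (c * n))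
        (schwartz-zippel (coefficient d) (size M*) (M* , coefficient-M*) coefficient-size)
      no-zeros-if-constant : size M* ≡ 0 → zeros (eval (coefficient d)) ≡ 0
      no-zeros-if-constant size≡0 = zeros-of-nonzero-constant (coefficient d) (M* , coefficient-M*)
        (λ M c≢0 → subst (size M ≤_) size≡0 (coefficient-size M c≢0))

lemma5p3 : ∀ {n m t : ℕ} (G : Graph n m) (w : Fin m → ℕ) (γ : Fin m → Vec Bool t)
             (α : Vec Bool t) (c : ℕ) → 1 ≤ c →
           ∃[ L ] (Unique L × All (InRange (c * n)) L
                  × All (Setup.SameMinDeg G w γ α) L
                  × (2 * c ∸ 1) * (c * n) ^ m ≤ (2 * c) * length L)
lemma5p3 {n} G w γ α c _ with MinDegree.lightest-matching G w γ α
... | inj₁ none = whole-grid (c * n) (2 * c) (MinDegree.no-matching⇒sameMinDeg G w γ α none)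
... | inj₂ (M* , M*-matching , lightest) =
  dense-subgrid (c * n) (2 * c) (λ x → eval (coefficient d) x ℤ.≟ 0ℤ) sameMinDeg (zeros-fraction c)
  where open MinDegree G w γ α
        open Lightest M* M*-matching lightest
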